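{- Let $\beta$, $x_i$, $x_j$, $y$ be indeterminates, let $c_1>c_2>\cdots>c_n>0$ be colors, and let $\mathcal{L}=\{0,c_1,\dots,c_n\}$. Let $W_{x,y}(\ell,t,r,b)$ be the vertex weights of the double Grothendieck model and $R_{x_i,x_j}(\mathrm{BL},\mathrm{TL},\mathrm{TR},\mathrm{BR})$ the $R$-weights, both defined in the context. Then the double Grothendieck model is integrable with this $R$-matrix, in the following sense: for all $a,b,c,d,e,f\in\mathcal{L}$, \[ \sum_{p,q,r\in\mathcal{L}} R_{x_i,x_j}(a,b,p,q)\,W_{x_j,y}(p,c,d,r)\,W_{x_i,y}(q,r,e,f) =\sum_{p,q,r\in\mathcal{L}} W_{x_i,y}(b,c,p,r)\,W_{x_j,y}(a,r,q,f)\,R_{x_i,x_j}(q,p,d,e). \]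
   Context: Write $x\oplus y:=x+y+\beta xy$. Colors are the positive numbers $c_1>\cdots>c_n$; the label $0$ means "no color". For a vertex, $W_{x,y}(\ell,t,r,b)$ denotes its weight when its left, top, right and bottom edges carry labels $\ell,t,r,b$. The nonzero weights are (here $c>c'$ are colors and $d$ is any color): $W(0,0,0,0)=\beta(x\oplus y)$; $W(c',c',c,c)=1$; $W(c,c',c,c')=1$; $W(0,d,0,d)=1$; $W(d,0,d,0)=1$; $W(d,d,0,0)=1+\beta(x\oplus y)$; $W(0,0,d,d)=1$. All other label configurations have weight $0$. The $R$-weights $R_{x_i,x_j}(\mathrm{BL},\mathrm{TL},\mathrm{TR},\mathrm{BR})$, indexed by the labels at the bottom-left, top-left, top-right and bottom-right of the $R$-vertex, are nonzero only in the following cases ($c>c'$ colors, $d$ any color): $R(0,0,0,0)=1+\beta x_i$; $R(0,d,d,0)=1+\beta x_i$; $R(0,d,0,d)=\beta(x_j-x_i)$; $R(d,0,0,d)=1+\beta x_j$; $R(c',c,c,c')=1+\beta x_i$; $R(c,c',c',c)=1+\beta x_j$; $R(c',c,c',c)=\beta(x_j-x_i)$; $R(d,d,d,d)=1+\beta x_i$. -}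

module Defs where

open import Level using (Level)
open import Data.Nat using (ℕ; suc)
open import Data.Fin using (Fin; zero; suc; _≟_; _<?_)
open import Data.Fin.Base using (_<_)
open import Data.Bool using (Bool; true; false; if_then_else_; _∧_)
open import Data.List using (List; foldr; map)
open import Data.List.Base using (allFin)
open import Relation.Nullary using (does)
open import Algebra.Bundles using (CommutativeRing)

-- Labels: Fin (suc n).  'zero' is the label 0 ("no color");
-- 'suc k' (k : Fin n) is a color.  Colors are ordered by k:
-- suc k stands for the color c_{n - k}, so that a larger k means a larger color
-- (c_1 > c_2 > ... > c_n > 0).  The weights only depend on this order.

_==_ : ∀ {n} → Fin n → Fin n → Bool
a == b = does (a ≟ b)

_<ᵇ_ : ∀ {n} → Fin n → Fin n → Bool
a <ᵇ b = does (a <? b)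

module Model {c ℓ : Level} (R : CommutativeRing c ℓ) where
  open CommutativeRing R

  ⊕ : Carrier → Carrier → Carrier → Carrier
  ⊕ β x y = x + y + β * x * y

  ∑ : ∀ {m} → (Fin m → Carrier) → Carrier
  ∑ {m} f = foldr _+_ 0# (map f (allFin m))

  W : ∀ {n} → (β x y : Carrier) → (l t r b : Fin (suc n)) → Carrier
  W β x y zero    zero    zero    zero    = β * ⊕ β x y
  W β x y zero    (suc d) zero    (suc e) = if d == e then 1# else 0#
  W β x y (suc d) zero    (suc e) zero    = if d == e then 1# else 0#
  W β x y (suc d) (suc e) zero    zero    = if d == e then 1# + β * ⊕ β x y else 0#
  W β x y zero    zero    (suc d) (suc e) = if d == e then 1# else 0#
  W β x y (suc a) (suc b) (suc c') (suc e) =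
    if (a == b) ∧ (c' == e) ∧ (b <ᵇ c') then 1#
    else if (a == c') ∧ (b == e) ∧ (b <ᵇ a) then 1#
    else 0#
  W β x y _ _ _ _ = 0#

  Rw : ∀ {n} → (β xi xj : Carrier) → (bl tl tr br : Fin (suc n)) → Carrier
  Rw β xi xj zero    zero    zero    zero    = 1# + β * xi
  Rw β xi xj zero    (suc d) (suc e) zero    = if d == e then 1# + β * xi else 0#
  Rw β xi xj zero    (suc d) zero    (suc e) = if d == e then β * (xj - xi) else 0#
  Rw β xi xj (suc d) zero    zero    (suc e) = if d == e then 1# + β * xj else 0#
  Rw β xi xj (suc a) (suc b) (suc c') (suc e) =
    if (a == b) ∧ (b == c') ∧ (c' == e) then 1# + β * xi
    else if (b == c') ∧ (a == e) ∧ (a <ᵇ b) then 1# + β * xi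
    else if (b == c') ∧ (a == e) ∧ (b <ᵇ a) then 1# + β * xj
    else if (a == c') ∧ (b == e) ∧ (a <ᵇ b) then β * (xj - xi)
    else 0#
  Rw β xi xj _ _ _ _ = 0#

-- W(l,t,r,b) vanishes unless b is forced by l, t and r, and R(bl,tl,tr,br) vanishes unless
-- (tr,br) is (tl,bl) or (bl,tl).  Hence on each side of the Yang–Baxter equation the triple sum
-- collapses to at most two products, one for each ordering of a pair of labels.  The weights see
-- the labels only through zero tests and the relative order of the colours, so a statement about
-- k labels follows from the case of k colours, where it is decided by computing with symbolic
-- weights.  Apart from literal coincidences of the two sides, the collapsed equation comes down to
-- ten polynomial identities; substituting xⱼ = xᵢ + t removes the only subtraction, so the
-- semiring solver proves them.

module Submission where

open import Defs
open import Level using (Level)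
open import Data.Nat using (ℕ; suc)
open import Data.Fin using (Fin)
open import Algebra.Bundles using (CommutativeRing)

open import Data.Nat as ℕ using (z≤n; _≤‴_; ≤‴-refl; ≤‴-step)
open import Data.Nat.Properties as ℕ using (≤⇒≤‴; ≮⇒≥)
open import Data.Fin using (zero; suc; punchIn; punchOut; _≟_; _<_; _<?_)
open import Data.Fin.Properties
  using (punchIn-injective; punchIn-mono-≤; punchIn-cancel-≤; punchInᵢ≢i; punchIn-punchOut;
         pigeonhole; ¬∀⟶∃¬; all?; suc-injective; <⇒≢; ≤∧≢⇒<)
open import Data.Bool using (Bool; true; false; if_then_else_; _∧_; _∨_)
open import Data.Bool.Properties using (if-float)
open import Data.List using (List; []; _∷_; map; foldr; filter; tabulate)
open import Data.List.Properties using (map-tabulate; map-∘; map-cong; filter-accept; filter-reject)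
import Data.List.Properties as List using (≡-dec)
import Data.List.Membership.DecPropositional as ListMembership
import Data.List.Relation.Unary.All as All
open All using (All; []; _∷_)
open import Data.Vec as Vec using (Vec; []; _∷_)
open import Data.Vec.Relation.Unary.Any using (here; there; index; any?)
open import Data.Vec.Membership.Propositional using () renaming (_∈_ to _∈ᵥ_; _∉_ to _∉ᵥ_)
open import Data.Product using (_×_; _,_; proj₁; proj₂; ∃-syntax; uncurry; swap)
import Data.Product.Properties as Product using (≡-dec)
open import Data.Sum using (_⊎_; inj₁; inj₂)
open import Function using (_∘_; id; _⇔_; mk⇔; Equivalence)
open import Relation.Binary.PropositionalEquality
  using (_≡_; _≢_; refl; sym; trans; cong; cong₂; subst; module ≡-Reasoning)
open import Relation.Nullary using (Dec; yes; no; does; ¬_; ¬?)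
open import Relation.Nullary.Decidable using (dec-true; dec-false; from-yes; map′; _⊎-dec_; _×-dec_)
open import Relation.Unary using (Pred; Decidable)
open import Relation.Binary.Definitions using (DecidableEquality)

-- The possible values of W and R, encoded in Fin so that they inherit decidable equality.
WValue : Set
WValue = Fin 4

pattern 0ʷ       = zero
pattern 1ʷ       = suc zero
pattern β[x⊕y]   = suc (suc zero)
pattern 1+β[x⊕y] = suc (suc (suc zero))

RValue : Set
RValue = Fin 4

pattern 0ʳ       = zero
pattern 1+βxᵢ    = suc zero
pattern 1+βxⱼ    = suc (suc zero)
pattern β[xⱼ-xᵢ] = suc (suc (suc zero))

Wˢ : ∀ {n} → (l t r b : Fin (suc n)) → WValue
Wˢ zero    zero    zero    zero    = β[x⊕y]
Wˢ zero    (suc d) zero    (suc e) = if d == e then 1ʷ else 0ʷ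
Wˢ (suc d) zero    (suc e) zero    = if d == e then 1ʷ else 0ʷ
Wˢ (suc d) (suc e) zero    zero    = if d == e then 1+β[x⊕y] else 0ʷ
Wˢ zero    zero    (suc d) (suc e) = if d == e then 1ʷ else 0ʷ
Wˢ (suc a) (suc b) (suc c) (suc e) =
  if (a == b) ∧ (c == e) ∧ (b <ᵇ c) then 1ʷ
  else if (a == c) ∧ (b == e) ∧ (b <ᵇ a) then 1ʷ
  else 0ʷ
Wˢ _ _ _ _ = 0ʷ

Rˢ : ∀ {n} → (bl tl tr br : Fin (suc n)) → RValue
Rˢ zero    zero    zero    zero    = 1+βxᵢ
Rˢ zero    (suc d) (suc e) zero    = if d == e then 1+βxᵢ else 0ʳ
Rˢ zero    (suc d) zero    (suc e) = if d == e then β[xⱼ-xᵢ] else 0ʳ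
Rˢ (suc d) zero    zero    (suc e) = if d == e then 1+βxⱼ else 0ʳ
Rˢ (suc a) (suc b) (suc c) (suc e) =
  if (a == b) ∧ (b == c) ∧ (c == e) then 1+βxᵢ
  else if (b == c) ∧ (a == e) ∧ (a <ᵇ b) then 1+βxᵢ
  else if (b == c) ∧ (a == e) ∧ (b <ᵇ a) then 1+βxⱼ
  else if (a == c) ∧ (b == e) ∧ (a <ᵇ b) then β[xⱼ-xᵢ]
  else 0ʳ
Rˢ _ _ _ _ = 0ʳ

forcedBottom : ∀ {n} → Fin n → Fin n → Fin n → Fin n
forcedBottom l t r = if l == t then r else t

orderings : ∀ {n} → Fin n → Fin n → List (Fin n × Fin n)
orderings u v = if u == v then (u , v) ∷ [] else (u , v) ∷ (v , u) ∷ []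

orderings-diagonal : ∀ {n} (u : Fin n) → orderings u u ≡ (u , u) ∷ []
orderings-diagonal u = cong (if_then _ else _) (dec-true (u ≟ u) refl)

orderings-offDiagonal : ∀ {n} {u v : Fin n} → u ≢ v → orderings u v ≡ (u , v) ∷ (v , u) ∷ []
orderings-offDiagonal {u = u} {v} u≢v = cong (if_then _ else _) (dec-false (u ≟ v) u≢v)

-- The factors R · Wⱼ · Wᵢ of a product, in this order on both sides of the equation.
Monomial : Set
Monomial = RValue × WValue × WValue

lhsTerm rhsTerm : ∀ {n} (a b c d e f : Fin (suc n)) → Fin (suc n) × Fin (suc n) → Monomial
lhsTerm a b c d e f (p , q) = let r = forcedBottom p c d in Rˢ a b p q , Wˢ p c d r , Wˢ q r e f
rhsTerm a b c d e f (p , q) = let r = forcedBottom b c p in Rˢ q p d e , Wˢ a r q f , Wˢ b c p r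

lhsˢ rhsˢ : ∀ {n} (a b c d e f : Fin (suc n)) → List Monomial
lhsˢ a b c d e f = map (lhsTerm a b c d e f) (orderings b a)
rhsˢ a b c d e f = map (rhsTerm a b c d e f) (orderings d e)

HasZeroFactor : Monomial → Set
HasZeroFactor (r , wⱼ , wᵢ) = r ≡ 0ʳ ⊎ wⱼ ≡ 0ʷ ⊎ wᵢ ≡ 0ʷ

hasZeroFactor? : Decidable HasZeroFactor
hasZeroFactor? (r , wⱼ , wᵢ) = (r ≟ 0ʳ) ⊎-dec (wⱼ ≟ 0ʷ) ⊎-dec (wᵢ ≟ 0ʷ)

dropZeros : List Monomial → List Monomial
dropZeros = filter (¬? ∘ hasZeroFactor?)

Identity : Set
Identity = List Monomial × List Monomial

-- Every pair of differing zero-free sides met by the finite check below.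
yangBaxterCases : List Identity
yangBaxterCases =
    ((1+βxᵢ , 1ʷ , 1ʷ) ∷ (β[xⱼ-xᵢ] , 1ʷ , 1ʷ) ∷ [] , (1+βxⱼ , 1ʷ , 1ʷ) ∷ [])
  ∷ ((1+βxᵢ , 1ʷ , β[x⊕y]) ∷ (β[xⱼ-xᵢ] , 1ʷ , 1+β[x⊕y]) ∷ [] , (1+βxᵢ , β[x⊕y] , 1ʷ) ∷ [])
  ∷ ((1+βxᵢ , 1ʷ , 1+β[x⊕y]) ∷ (β[xⱼ-xᵢ] , 1ʷ , 1+β[x⊕y]) ∷ [] , (1+βxᵢ , 1+β[x⊕y] , 1ʷ) ∷ [])
  ∷ ((1+βxᵢ , β[x⊕y] , 1ʷ) ∷ [] , (1+βxⱼ , 1ʷ , β[x⊕y]) ∷ (β[xⱼ-xᵢ] , 1ʷ , 1ʷ) ∷ [])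
  ∷ ((1+βxᵢ , 1+β[x⊕y] , 1ʷ) ∷ [] , (1+βxⱼ , 1ʷ , 1+β[x⊕y]) ∷ [])
  ∷ ((1+βxᵢ , 1+β[x⊕y] , 1ʷ) ∷ (β[xⱼ-xᵢ] , 1ʷ , 1ʷ) ∷ []
    , (1+βxⱼ , 1ʷ , 1+β[x⊕y]) ∷ (β[xⱼ-xᵢ] , 1ʷ , 1ʷ) ∷ [])
  ∷ ((1+βxᵢ , 1+β[x⊕y] , β[x⊕y]) ∷ (β[xⱼ-xᵢ] , 1ʷ , 1+β[x⊕y]) ∷ []
    , (1+βxᵢ , β[x⊕y] , 1+β[x⊕y]) ∷ [])
  ∷ ((1+βxⱼ , 1ʷ , 1+β[x⊕y]) ∷ [] , (1+βxᵢ , 1+β[x⊕y] , 1ʷ) ∷ [])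
  ∷ ((1+βxⱼ , β[x⊕y] , 1ʷ) ∷ [] , (1+βxⱼ , 1ʷ , β[x⊕y]) ∷ (β[xⱼ-xᵢ] , 1+β[x⊕y] , 1ʷ) ∷ [])
  ∷ ((1+βxⱼ , 1+β[x⊕y] , 1ʷ) ∷ [] , (1+βxⱼ , 1ʷ , 1+β[x⊕y]) ∷ (β[xⱼ-xᵢ] , 1+β[x⊕y] , 1ʷ) ∷ [])
  ∷ []

_≟ₘ_ : DecidableEquality Monomial
_≟ₘ_ = Product.≡-dec _≟_ (Product.≡-dec _≟_ _≟_)

open ListMembership (Product.≡-dec (List.≡-dec _≟ₘ_) (List.≡-dec _≟ₘ_)) using (_∈_; _∈?_)

Balanced : Identity → Set
Balanced (l , r) = l ≡ r ⊎ (l , r) ∈ yangBaxterCases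

balanced? : Decidable Balanced
balanced? (l , r) = List.≡-dec _≟ₘ_ l r ⊎-dec ((l , r) ∈? yangBaxterCases)

-- Relabelling colours in an order-preserving way

does-cong : ∀ {a b} {A : Set a} {B : Set b} → A ⇔ B → (a? : Dec A) (b? : Dec B) → does a? ≡ does b?
does-cong A⇔B a? (yes b) = dec-true a? (Equivalence.from A⇔B b)
does-cong A⇔B a? (no ¬b) = dec-false a? (¬b ∘ Equivalence.to A⇔B)

punchIn-== : ∀ {n} (i : Fin (suc n)) (a b : Fin n) → (punchIn i a == punchIn i b) ≡ (a == b)
punchIn-== i a b =
  does-cong (mk⇔ (punchIn-injective i a b) (cong (punchIn i))) (punchIn i a ≟ punchIn i b) (a ≟ b)

punchIn-<ᵇ : ∀ {n} (i : Fin (suc n)) (a b : Fin n) → (punchIn i a <ᵇ punchIn i b) ≡ (a <ᵇ b)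
punchIn-<ᵇ i a b = does-cong (mk⇔ cancel mono) (punchIn i a <? punchIn i b) (a <? b)
  where
  mono : a < b → punchIn i a < punchIn i b
  mono a<b = ≤∧≢⇒< (punchIn-mono-≤ i a b (ℕ.<⇒≤ a<b)) (<⇒≢ a<b ∘ punchIn-injective i a b)
  cancel : punchIn i a < punchIn i b → a < b
  cancel lt = ≤∧≢⇒< (punchIn-cancel-≤ i a b (ℕ.<⇒≤ lt)) (<⇒≢ lt ∘ cong (punchIn i))

skip : ∀ {n} → Fin (suc n) → Fin (suc n) → Fin (suc (suc n))
skip i zero    = zero
skip i (suc c) = suc (punchIn i c)

skip² : ∀ {n} → Fin (suc n) → Fin (suc n) × Fin (suc n) → Fin (suc (suc n)) × Fin (suc (suc n))
skip² i (p , q) = skip i p , skip i q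

skip-injective : ∀ {n} (i : Fin (suc n)) {a b : Fin (suc n)} → skip i a ≡ skip i b → a ≡ b
skip-injective i {zero}  {zero}  _  = refl
skip-injective i {zero}  {suc b} ()
skip-injective i {suc a} {zero}  ()
skip-injective i {suc a} {suc b} eq = cong suc (punchIn-injective i a b (suc-injective eq))

skip-== : ∀ {n} (i : Fin (suc n)) (a b : Fin (suc n)) → (skip i a == skip i b) ≡ (a == b)
skip-== i a b = does-cong (mk⇔ (skip-injective i) (cong (skip i))) (skip i a ≟ skip i b) (a ≟ b)

forcedBottom-skip : ∀ {n} (i : Fin (suc n)) (l t r : Fin (suc n)) →
                    forcedBottom (skip i l) (skip i t) (skip i r) ≡ skip i (forcedBottom l t r)
forcedBottom-skip i l t r rewrite skip-== i l t = sym (if-float (skip i) (l == t))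

orderings-skip : ∀ {n} (i : Fin (suc n)) (u v : Fin (suc n)) →
                 orderings (skip i u) (skip i v) ≡ map (skip² i) (orderings u v)
orderings-skip i u v rewrite skip-== i u v with u == v
... | true  = refl
... | false = refl

Wˢ-skip : ∀ {n} (i : Fin (suc n)) (l t r b : Fin (suc n)) →
          Wˢ (skip i l) (skip i t) (skip i r) (skip i b) ≡ Wˢ l t r b
Wˢ-skip i zero    zero    zero    zero    = refl
Wˢ-skip i zero    zero    zero    (suc e) = refl
Wˢ-skip i zero    zero    (suc c) zero    = refl
Wˢ-skip i zero    zero    (suc c) (suc e) rewrite punchIn-== i c e = refl
Wˢ-skip i zero    (suc t) zero    zero    = refl
Wˢ-skip i zero    (suc t) zero    (suc e) rewrite punchIn-== i t e = refl
Wˢ-skip i zero    (suc t) (suc c) _       = refl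
Wˢ-skip i (suc l) zero    zero    _       = refl
Wˢ-skip i (suc l) zero    (suc c) zero    rewrite punchIn-== i l c = refl
Wˢ-skip i (suc l) zero    (suc c) (suc e) = refl
Wˢ-skip i (suc l) (suc t) zero    zero    rewrite punchIn-== i l t = refl
Wˢ-skip i (suc l) (suc t) zero    (suc e) = refl
Wˢ-skip i (suc l) (suc t) (suc c) zero    = refl
Wˢ-skip i (suc l) (suc t) (suc c) (suc e)
  rewrite punchIn-== i l t | punchIn-== i c e | punchIn-<ᵇ i t c
        | punchIn-== i l c | punchIn-== i t e | punchIn-<ᵇ i t l = refl

Rˢ-skip : ∀ {n} (i : Fin (suc n)) (bl tl tr br : Fin (suc n)) →
          Rˢ (skip i bl) (skip i tl) (skip i tr) (skip i br) ≡ Rˢ bl tl tr br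
Rˢ-skip i zero    zero    zero    zero    = refl
Rˢ-skip i zero    zero    zero    (suc e) = refl
Rˢ-skip i zero    zero    (suc c) _       = refl
Rˢ-skip i zero    (suc t) zero    zero    = refl
Rˢ-skip i zero    (suc t) zero    (suc e) rewrite punchIn-== i t e = refl
Rˢ-skip i zero    (suc t) (suc c) zero    rewrite punchIn-== i t c = refl
Rˢ-skip i zero    (suc t) (suc c) (suc e) = refl
Rˢ-skip i (suc l) zero    zero    zero    = refl
Rˢ-skip i (suc l) zero    zero    (suc e) rewrite punchIn-== i l e = refl
Rˢ-skip i (suc l) zero    (suc c) _       = refl
Rˢ-skip i (suc l) (suc t) zero    _       = refl
Rˢ-skip i (suc l) (suc t) (suc c) zero    = refl
Rˢ-skip i (suc l) (suc t) (suc c) (suc e)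
  rewrite punchIn-== i l t | punchIn-== i t c | punchIn-== i c e | punchIn-== i l e
        | punchIn-<ᵇ i l t | punchIn-<ᵇ i t l | punchIn-== i l c | punchIn-== i t e = refl

map-orderings-skip : ∀ {n a} {A : Set a} (i : Fin (suc n)) {h : Fin (suc n) × Fin (suc n) → A}
                     {h′ : Fin (suc (suc n)) × Fin (suc (suc n)) → A} (u v : Fin (suc n)) →
                     (∀ o → h′ (skip² i o) ≡ h o) →
                     map h′ (orderings (skip i u) (skip i v)) ≡ map h (orderings u v)
map-orderings-skip i {h} {h′} u v h′∘skip≗h = begin
  map h′ (orderings (skip i u) (skip i v)) ≡⟨ cong (map h′) (orderings-skip i u v) ⟩
  map h′ (map (skip² i) (orderings u v))   ≡⟨ map-∘ (orderings u v) ⟨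
  map (h′ ∘ skip² i) (orderings u v)       ≡⟨ map-cong h′∘skip≗h (orderings u v) ⟩
  map h (orderings u v)                    ∎
  where open ≡-Reasoning

lhsˢ-skip : ∀ {n} (i : Fin (suc n)) (a b c d e f : Fin (suc n)) →
            lhsˢ (skip i a) (skip i b) (skip i c) (skip i d) (skip i e) (skip i f) ≡ lhsˢ a b c d e f
lhsˢ-skip i a b c d e f = map-orderings-skip i b a term-skip
  where
  term-skip : ∀ o → lhsTerm (skip i a) (skip i b) (skip i c) (skip i d) (skip i e) (skip i f) (skip² i o)
                    ≡ lhsTerm a b c d e f o
  term-skip (p , q)
    rewrite forcedBottom-skip i p c d | Rˢ-skip i a b p q
          | Wˢ-skip i p c d (forcedBottom p c d) | Wˢ-skip i q (forcedBottom p c d) e f = refl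

rhsˢ-skip : ∀ {n} (i : Fin (suc n)) (a b c d e f : Fin (suc n)) →
            rhsˢ (skip i a) (skip i b) (skip i c) (skip i d) (skip i e) (skip i f) ≡ rhsˢ a b c d e f
rhsˢ-skip i a b c d e f = map-orderings-skip i d e term-skip
  where
  term-skip : ∀ o → rhsTerm (skip i a) (skip i b) (skip i c) (skip i d) (skip i e) (skip i f) (skip² i o)
                    ≡ rhsTerm a b c d e f o
  term-skip (p , q)
    rewrite forcedBottom-skip i b c p | Rˢ-skip i q p d e
          | Wˢ-skip i a (forcedBottom b c p) q f | Wˢ-skip i b c p (forcedBottom b c p) = refl

-- Reduction to few colours

index-injective : ∀ {a k} {A : Set a} {x y : A} {v : Vec A k} (p : x ∈ᵥ v) (q : y ∈ᵥ v) →
                  index p ≡ index q → x ≡ y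
index-injective (here refl) (here refl) _  = refl
index-injective (here _)    (there _)   ()
index-injective (there _)   (here _)    ()
index-injective (there p)   (there q)   eq = index-injective p q (suc-injective eq)

missingColour : ∀ {n k} (v : Vec (Fin (suc n)) k) → k ℕ.< n → ∃[ i ] suc i ∉ᵥ v
missingColour {n} v k<n = ¬∀⟶∃¬ n (λ i → suc i ∈ᵥ v) (λ i → any? (suc i ≟_) v) allPresent⇒⊥
  where
  allPresent⇒⊥ : ¬ (∀ i → suc i ∈ᵥ v)
  allPresent⇒⊥ present =
    let (i , j , i<j , sameIndex) = pigeonhole k<n (index ∘ present)
    in <⇒≢ i<j (suc-injective (index-injective (present i) (present j) sameIndex))

unskip : ∀ {n k} {i : Fin (suc n)} (v : Vec (Fin (suc (suc n))) k) → suc i ∉ᵥ v →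
         ∃[ v′ ] Vec.map (skip i) v′ ≡ v
unskip []      _   = [] , refl
unskip (x ∷ v) i∉v =
  let (y , skip-y≡x) = preimage x (i∉v ∘ here)
      (v′ , skip-v′≡v) = unskip v (i∉v ∘ there)
  in y ∷ v′ , cong₂ _∷_ skip-y≡x skip-v′≡v
  where
  preimage : ∀ {n} {i : Fin (suc n)} x → suc i ≢ x → ∃[ y ] skip i y ≡ x
  preimage zero    _   = zero , refl
  preimage (suc c) i≢x = suc (punchOut (i≢x ∘ cong suc)) , cong suc (punchIn-punchOut _)

-- Labels with more colours than entries miss a colour, so they come from fewer colours by skip.
module ColourReduction {a} {A : Set a} (k : ℕ) (F : ∀ {n} → Vec (Fin (suc n)) k → A)
  (F-skip : ∀ {n} (i : Fin (suc n)) (v : Vec (Fin (suc n)) k) → F (Vec.map (skip i) v) ≡ F v)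
  where

  raise : ∀ {n m} → n ≤‴ m → (v : Vec (Fin (suc n)) k) → ∃[ w ] F {m} w ≡ F v
  raise ≤‴-refl       v = v , refl
  raise (≤‴-step n<m) v = let (w , eq) = raise n<m (Vec.map (skip zero) v) in w , trans eq (F-skip zero v)

  attainedWithKColours : ∀ n (v : Vec (Fin (suc n)) k) → ∃[ w ] F {k} w ≡ F v
  attainedWithKColours ℕ.zero  v = raise (≤⇒≤‴ z≤n) v
  attainedWithKColours (suc n) v with k ℕ.<? suc n
  ... | no  k≮1+n = raise (≤⇒≤‴ (≮⇒≥ k≮1+n)) v
  ... | yes k<1+n =
    let (i , i∉v) = missingColour v k<1+n
        (v′ , skip-v′≡v) = unskip v i∉v
        (w , eq) = attainedWithKColours n v′
    in w , trans eq (trans (sym (F-skip i v′)) (cong F skip-v′≡v))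

  everywhere : ∀ {p} (P : Pred A p) → (∀ (w : Vec (Fin (suc k)) k) → P (F w)) →
               ∀ {n} (v : Vec (Fin (suc n)) k) → P (F v)
  everywhere P check {n} v = let (w , Fw≡Fv) = attainedWithKColours n v in subst P Fw≡Fv (check w)

∀-Vec? : ∀ {m p} k {P : Pred (Vec (Fin m) k) p} → Decidable P → Dec (∀ v → P v)
∀-Vec? ℕ.zero  P? = map′ (λ { p [] → p }) (λ ∀P → ∀P []) (P? [])
∀-Vec? (suc k) P? = map′ (λ { ∀P (x ∷ v) → ∀P x v }) (λ ∀P x v → ∀P (x ∷ v))
                         (all? λ x → ∀-Vec? k (P? ∘ (x ∷_)))

-- Wˢ overwritten by 0ʷ where b is the forced bottom label: the support property becomes an
-- equation between skip-invariant functions of the labels, to which ColourReduction applies.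
offSupportʷ : ∀ {n} → Vec (Fin (suc n)) 4 → WValue
offSupportʷ (l ∷ t ∷ r ∷ b ∷ []) = if b == forcedBottom l t r then 0ʷ else Wˢ l t r b

Wˢ-support : ∀ {n} (l t r b : Fin (suc n)) → b ≢ forcedBottom l t r → Wˢ l t r b ≡ 0ʷ
Wˢ-support l t r b b≢forced = begin
  Wˢ l t r b                       ≡⟨ cong (if_then 0ʷ else Wˢ l t r b) (dec-false (b ≟ _) b≢forced) ⟨
  offSupportʷ (l ∷ t ∷ r ∷ b ∷ []) ≡⟨ ColourReduction.everywhere 4 offSupportʷ offSupport-skip (_≡ 0ʷ)
                                        withFourColours (l ∷ t ∷ r ∷ b ∷ []) ⟩
  0ʷ                               ∎
  where
  offSupport-skip : ∀ {n} (i : Fin (suc n)) v → offSupportʷ (Vec.map (skip i) v) ≡ offSupportʷ v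
  offSupport-skip i (l ∷ t ∷ r ∷ b ∷ [])
    rewrite forcedBottom-skip i l t r | skip-== i b (forcedBottom l t r) | Wˢ-skip i l t r b = refl
  withFourColours : ∀ (v : Vec (Fin 5) 4) → offSupportʷ v ≡ 0ʷ
  withFourColours = from-yes (∀-Vec? 4 λ v → offSupportʷ {4} v ≟ 0ʷ)
  open ≡-Reasoning

_==²_ : ∀ {n} → Fin n × Fin n → Fin n × Fin n → Bool
(a , b) ==² (c , d) = (a == c) ∧ (b == d)

≢⇒==²-false : ∀ {n} {x y : Fin n × Fin n} → x ≢ y → (x ==² y) ≡ false
≢⇒==²-false {x = a , b} {c , d} x≢y = dec-false ((a ≟ c) ×-dec (b ≟ d)) (x≢y ∘ uncurry (cong₂ _,_))

offSupportʳ : ∀ {n} → Vec (Fin (suc n)) 4 → RValue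
offSupportʳ (bl ∷ tl ∷ tr ∷ br ∷ []) =
  if ((tr , br) ==² (tl , bl)) ∨ ((tr , br) ==² (bl , tl)) then 0ʳ else Rˢ bl tl tr br

Rˢ-support : ∀ {n} (bl tl tr br : Fin (suc n)) → (tr , br) ≢ (tl , bl) → (tr , br) ≢ (bl , tl) →
             Rˢ bl tl tr br ≡ 0ʳ
Rˢ-support bl tl tr br ≢straight ≢crossed = begin
  Rˢ bl tl tr br                      ≡⟨ cong₂ (λ s c → if s ∨ c then 0ʳ else Rˢ bl tl tr br)
                                               (≢⇒==²-false ≢straight) (≢⇒==²-false ≢crossed) ⟨
  offSupportʳ (bl ∷ tl ∷ tr ∷ br ∷ []) ≡⟨ ColourReduction.everywhere 4 offSupportʳ offSupport-skip (_≡ 0ʳ)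
                                           withFourColours (bl ∷ tl ∷ tr ∷ br ∷ []) ⟩
  0ʳ                                  ∎
  where
  offSupport-skip : ∀ {n} (i : Fin (suc n)) v → offSupportʳ (Vec.map (skip i) v) ≡ offSupportʳ v
  offSupport-skip i (bl ∷ tl ∷ tr ∷ br ∷ [])
    rewrite skip-== i tr tl | skip-== i br bl | skip-== i tr bl | skip-== i br tl
          | Rˢ-skip i bl tl tr br = refl
  withFourColours : ∀ (v : Vec (Fin 5) 4) → offSupportʳ v ≡ 0ʳ
  withFourColours = from-yes (∀-Vec? 4 λ v → offSupportʳ {4} v ≟ 0ʳ)
  open ≡-Reasoning

sides : ∀ {n} → Vec (Fin (suc n)) 6 → Identity
sides (a ∷ b ∷ c ∷ d ∷ e ∷ f ∷ []) = dropZeros (lhsˢ a b c d e f) , dropZeros (rhsˢ a b c d e f)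

sides-balanced : ∀ {n} (a b c d e f : Fin (suc n)) →
                 Balanced (dropZeros (lhsˢ a b c d e f) , dropZeros (rhsˢ a b c d e f))
sides-balanced a b c d e f =
  ColourReduction.everywhere 6 sides sides-skip Balanced withSixColours (a ∷ b ∷ c ∷ d ∷ e ∷ f ∷ [])
  where
  sides-skip : ∀ {n} (i : Fin (suc n)) v → sides (Vec.map (skip i) v) ≡ sides v
  sides-skip i (a ∷ b ∷ c ∷ d ∷ e ∷ f ∷ []) =
    cong₂ (λ l r → dropZeros l , dropZeros r) (lhsˢ-skip i a b c d e f) (rhsˢ-skip i a b c d e f)
  withSixColours : ∀ (v : Vec (Fin 7) 6) → Balanced (sides v)
  withSixColours = from-yes (∀-Vec? 6 (balanced? ∘ sides {6}))

-- Finite sums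

module Sums {c ℓ} (R : CommutativeRing c ℓ) where
  open CommutativeRing R hiding (zero) renaming (refl to ≈-refl; sym to ≈-sym; trans to ≈-trans)
  open Model R using (∑)
  open import Algebra.Properties.CommutativeMonoid.Sum +-commutativeMonoid
    using (sum; sum-remove; sum-cong-≋; sum-replicate-zero)
  open import Relation.Binary.Reasoning.Setoid setoid

  sumMap : ∀ {a} {A : Set a} → (A → Carrier) → List A → Carrier
  sumMap f = foldr (λ x s → f x + s) 0#

  sumMap-map : ∀ {a b} {A : Set a} {B : Set b} {f : A → Carrier} {g : B → Carrier} {h : A → B} →
               (∀ x → f x ≈ g (h x)) → ∀ xs → sumMap f xs ≈ sumMap g (map h xs)
  sumMap-map f≈g∘h []       = ≈-refl
  sumMap-map f≈g∘h (x ∷ xs) = +-cong (f≈g∘h x) (sumMap-map f≈g∘h xs)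

  ∑≡sum : ∀ {m} (f : Fin m → Carrier) → ∑ f ≡ sum f
  ∑≡sum {ℕ.zero} f = refl
  ∑≡sum {suc m}  f = cong (f zero +_) (trans (cong (foldr _+_ 0#) tail≡) (∑≡sum (f ∘ suc)))
    where
    tail≡ : map f (tabulate suc) ≡ map (f ∘ suc) (tabulate id)
    tail≡ = trans (map-tabulate suc f) (sym (map-tabulate id (f ∘ suc)))

  ∑-cong : ∀ {m} {f g : Fin m → Carrier} → (∀ i → f i ≈ g i) → ∑ f ≈ ∑ g
  ∑-cong {f = f} {g} f≈g = begin
    ∑ f   ≡⟨ ∑≡sum f ⟩
    sum f ≈⟨ sum-cong-≋ f≈g ⟩
    sum g ≡⟨ ∑≡sum g ⟨
    ∑ g   ∎

  ∑-zero : ∀ {m} {f : Fin m → Carrier} → (∀ i → f i ≈ 0#) → ∑ f ≈ 0#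
  ∑-zero {m} {f} f≈0 = begin
    ∑ f                ≡⟨ ∑≡sum f ⟩
    sum f              ≈⟨ sum-cong-≋ f≈0 ⟩
    sum {m} (λ _ → 0#) ≈⟨ sum-replicate-zero m ⟩
    0#                 ∎

  ∑-single : ∀ {m} {f : Fin m → Carrier} (i : Fin m) → (∀ j → j ≢ i → f j ≈ 0#) → ∑ f ≈ f i
  ∑-single {suc m} {f} i vanish = begin
    ∑ f                       ≡⟨ ∑≡sum f ⟩
    sum f                     ≈⟨ sum-remove {i = i} f ⟩
    f i + sum (f ∘ punchIn i) ≡⟨ cong (f i +_) (∑≡sum (f ∘ punchIn i)) ⟨
    f i + ∑ (f ∘ punchIn i)   ≈⟨ +-congˡ (∑-zero λ j → vanish (punchIn i j) (punchInᵢ≢i i j)) ⟩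
    f i + 0#                  ≈⟨ +-identityʳ (f i) ⟩
    f i                       ∎

  ∑-pair : ∀ {m} {f : Fin m → Carrier} (i j : Fin m) → i ≢ j → (∀ k → k ≢ i → k ≢ j → f k ≈ 0#) →
           ∑ f ≈ f i + f j
  ∑-pair {suc m} {f} i j i≢j vanish = begin
    ∑ f                                ≡⟨ ∑≡sum f ⟩
    sum f                              ≈⟨ sum-remove {i = i} f ⟩
    f i + sum (f ∘ punchIn i)          ≡⟨ cong (f i +_) (∑≡sum (f ∘ punchIn i)) ⟨
    f i + ∑ (f ∘ punchIn i)            ≈⟨ +-congˡ (∑-single (punchOut i≢j) vanish′) ⟩
    f i + f (punchIn i (punchOut i≢j)) ≡⟨ cong (λ k → f i + f k) (punchIn-punchOut i≢j) ⟩
    f i + f j                          ∎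
    where
    vanish′ : ∀ k → k ≢ punchOut i≢j → f (punchIn i k) ≈ 0#
    vanish′ k k≢ = vanish (punchIn i k) (punchInᵢ≢i i k)
      (λ eq → k≢ (punchIn-injective i k _ (trans eq (sym (punchIn-punchOut i≢j)))))

  ∑∑-orderings : ∀ {m} (f : Fin m → Fin m → Carrier) (u v : Fin m) →
                 (∀ p q → (p , q) ≢ (u , v) → (p , q) ≢ (v , u) → f p q ≈ 0#) →
                 ∑ (λ p → ∑ (f p)) ≈ sumMap (uncurry f) (orderings u v)
  ∑∑-orderings f u v vanish = byCases (u ≟ v)
    where
    byCases : Dec (u ≡ v) → ∑ (λ p → ∑ (f p)) ≈ sumMap (uncurry f) (orderings u v)
    byCases (yes refl) = begin
      ∑ (λ p → ∑ (f p)) ≈⟨ ∑-single u (λ p p≢u → ∑-zero λ q →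
                             vanish p q (p≢u ∘ cong proj₁) (p≢u ∘ cong proj₁)) ⟩
      ∑ (f u)           ≈⟨ ∑-single u (λ q q≢u → vanish u q (q≢u ∘ cong proj₂) (q≢u ∘ cong proj₂)) ⟩
      f u u             ≈⟨ +-identityʳ (f u u) ⟨
      f u u + 0#        ≡⟨ cong (sumMap (uncurry f)) (orderings-diagonal u) ⟨
      sumMap (uncurry f) (orderings u u) ∎
    byCases (no u≢v) = begin
      ∑ (λ p → ∑ (f p))    ≈⟨ ∑-pair u v u≢v (λ p p≢u p≢v → ∑-zero λ q →
                                vanish p q (p≢u ∘ cong proj₁) (p≢v ∘ cong proj₁)) ⟩
      ∑ (f u) + ∑ (f v)    ≈⟨ +-cong
          (∑-single v λ q q≢v → vanish u q (q≢v ∘ cong proj₂) (u≢v ∘ cong proj₁))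
          (∑-single u λ q q≢u → vanish v q (u≢v ∘ sym ∘ cong proj₁) (q≢u ∘ cong proj₂)) ⟩
      f u v + f v u        ≈⟨ +-congˡ (+-identityʳ (f v u)) ⟨
      f u v + (f v u + 0#) ≡⟨ cong (sumMap (uncurry f)) (orderings-offDiagonal u≢v) ⟨
      sumMap (uncurry f) (orderings u v) ∎

-- Evaluating symbolic weights

module Evaluation {c ℓ} (R : CommutativeRing c ℓ) (β xᵢ xⱼ y : CommutativeRing.Carrier R) where
  open CommutativeRing R hiding (zero) renaming (refl to ≈-refl; sym to ≈-sym; trans to ≈-trans)
  open Model R
  open Sums R
  open import Relation.Binary.Reasoning.Setoid setoid

  ⟦_⟧ʷ : WValue → Carrier → Carrier
  ⟦ 0ʷ       ⟧ʷ x = 0#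
  ⟦ 1ʷ       ⟧ʷ x = 1#
  ⟦ β[x⊕y]   ⟧ʷ x = β * ⊕ β x y
  ⟦ 1+β[x⊕y] ⟧ʷ x = 1# + β * ⊕ β x y

  ⟦_⟧ʳ : RValue → Carrier
  ⟦ 0ʳ       ⟧ʳ = 0#
  ⟦ 1+βxᵢ    ⟧ʳ = 1# + β * xᵢ
  ⟦ 1+βxⱼ    ⟧ʳ = 1# + β * xⱼ
  ⟦ β[xⱼ-xᵢ] ⟧ʳ = β * (xⱼ - xᵢ)

  ⟦_⟧ₘ : Monomial → Carrier
  ⟦ r , wⱼ , wᵢ ⟧ₘ = ⟦ r ⟧ʳ * ⟦ wⱼ ⟧ʷ xⱼ * ⟦ wᵢ ⟧ʷ xᵢ

  ⟦_⟧ : List Monomial → Carrier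
  ⟦_⟧ = sumMap ⟦_⟧ₘ

  W≡⟦Wˢ⟧ : ∀ {n} x (l t r b : Fin (suc n)) → W β x y l t r b ≡ ⟦ Wˢ l t r b ⟧ʷ x
  W≡⟦Wˢ⟧ x zero    zero    zero    zero    = refl
  W≡⟦Wˢ⟧ x zero    zero    zero    (suc e) = refl
  W≡⟦Wˢ⟧ x zero    zero    (suc c) zero    = refl
  W≡⟦Wˢ⟧ x zero    zero    (suc c) (suc e) = sym (if-float (λ w → ⟦ w ⟧ʷ x) (c == e))
  W≡⟦Wˢ⟧ x zero    (suc t) zero    zero    = refl
  W≡⟦Wˢ⟧ x zero    (suc t) zero    (suc e) = sym (if-float (λ w → ⟦ w ⟧ʷ x) (t == e))
  W≡⟦Wˢ⟧ x zero    (suc t) (suc c) _       = refl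
  W≡⟦Wˢ⟧ x (suc l) zero    zero    _       = refl
  W≡⟦Wˢ⟧ x (suc l) zero    (suc c) zero    = sym (if-float (λ w → ⟦ w ⟧ʷ x) (l == c))
  W≡⟦Wˢ⟧ x (suc l) zero    (suc c) (suc e) = refl
  W≡⟦Wˢ⟧ x (suc l) (suc t) zero    zero    = sym (if-float (λ w → ⟦ w ⟧ʷ x) (l == t))
  W≡⟦Wˢ⟧ x (suc l) (suc t) zero    (suc e) = refl
  W≡⟦Wˢ⟧ x (suc l) (suc t) (suc c) zero    = refl
  W≡⟦Wˢ⟧ x (suc l) (suc t) (suc c) (suc e)
    with (l == t) ∧ (c == e) ∧ (t <ᵇ c) | (l == c) ∧ (t == e) ∧ (t <ᵇ l)
  ... | true  | _     = refl
  ... | false | true  = refl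
  ... | false | false = refl

  Rw≡⟦Rˢ⟧ : ∀ {n} (bl tl tr br : Fin (suc n)) → Rw β xᵢ xⱼ bl tl tr br ≡ ⟦ Rˢ bl tl tr br ⟧ʳ
  Rw≡⟦Rˢ⟧ zero    zero    zero    zero    = refl
  Rw≡⟦Rˢ⟧ zero    zero    zero    (suc e) = refl
  Rw≡⟦Rˢ⟧ zero    zero    (suc c) _       = refl
  Rw≡⟦Rˢ⟧ zero    (suc t) zero    zero    = refl
  Rw≡⟦Rˢ⟧ zero    (suc t) zero    (suc e) = sym (if-float ⟦_⟧ʳ (t == e))
  Rw≡⟦Rˢ⟧ zero    (suc t) (suc c) zero    = sym (if-float ⟦_⟧ʳ (t == c))
  Rw≡⟦Rˢ⟧ zero    (suc t) (suc c) (suc e) = refl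
  Rw≡⟦Rˢ⟧ (suc l) zero    zero    zero    = refl
  Rw≡⟦Rˢ⟧ (suc l) zero    zero    (suc e) = sym (if-float ⟦_⟧ʳ (l == e))
  Rw≡⟦Rˢ⟧ (suc l) zero    (suc c) _       = refl
  Rw≡⟦Rˢ⟧ (suc l) (suc t) zero    _       = refl
  Rw≡⟦Rˢ⟧ (suc l) (suc t) (suc c) zero    = refl
  Rw≡⟦Rˢ⟧ (suc l) (suc t) (suc c) (suc e)
    with (l == t) ∧ (t == c) ∧ (c == e) | (t == c) ∧ (l == e) ∧ (l <ᵇ t)
       | (t == c) ∧ (l == e) ∧ (t <ᵇ l) | (l == c) ∧ (t == e) ∧ (l <ᵇ t)
  ... | true  | _     | _     | _     = refl
  ... | false | true  | _     | _     = refl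
  ... | false | false | true  | _     = refl
  ... | false | false | false | true  = refl
  ... | false | false | false | false = refl

  product-zero : ∀ {u v w} → u ≈ 0# ⊎ v ≈ 0# ⊎ w ≈ 0# → u * v * w ≈ 0#
  product-zero {u} {v} {w} (inj₁ u≈0) = begin
    u * v * w   ≈⟨ *-congʳ (*-congʳ u≈0) ⟩
    0# * v * w  ≈⟨ *-congʳ (zeroˡ v) ⟩
    0# * w      ≈⟨ zeroˡ w ⟩
    0#          ∎
  product-zero {u} {v} {w} (inj₂ (inj₁ v≈0)) = begin
    u * v * w   ≈⟨ *-congʳ (*-congˡ v≈0) ⟩
    u * 0# * w  ≈⟨ *-congʳ (zeroʳ u) ⟩
    0# * w      ≈⟨ zeroˡ w ⟩
    0#          ∎
  product-zero {u} {v} {w} (inj₂ (inj₂ w≈0)) = begin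
    u * v * w   ≈⟨ *-congˡ w≈0 ⟩
    u * v * 0#  ≈⟨ zeroʳ (u * v) ⟩
    0#          ∎

  hasZeroFactor⇒≈0 : ∀ m → HasZeroFactor m → ⟦ m ⟧ₘ ≈ 0#
  hasZeroFactor⇒≈0 _ (inj₁ refl)        = product-zero (inj₁ ≈-refl)
  hasZeroFactor⇒≈0 _ (inj₂ (inj₁ refl)) = product-zero (inj₂ (inj₁ ≈-refl))
  hasZeroFactor⇒≈0 _ (inj₂ (inj₂ refl)) = product-zero (inj₂ (inj₂ ≈-refl))

  ⟦dropZeros⟧ : ∀ ms → ⟦ dropZeros ms ⟧ ≈ ⟦ ms ⟧
  ⟦dropZeros⟧ []       = ≈-refl
  ⟦dropZeros⟧ (m ∷ ms) with hasZeroFactor? m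
  ... | no ¬z = begin
    ⟦ dropZeros (m ∷ ms) ⟧    ≡⟨ cong ⟦_⟧ (filter-accept (¬? ∘ hasZeroFactor?) ¬z) ⟩
    ⟦ m ⟧ₘ + ⟦ dropZeros ms ⟧ ≈⟨ +-congˡ (⟦dropZeros⟧ ms) ⟩
    ⟦ m ⟧ₘ + ⟦ ms ⟧           ∎
  ... | yes z = begin
    ⟦ dropZeros (m ∷ ms) ⟧ ≡⟨ cong ⟦_⟧ (filter-reject (¬? ∘ hasZeroFactor?) (λ ¬z → ¬z z)) ⟩
    ⟦ dropZeros ms ⟧       ≈⟨ ⟦dropZeros⟧ ms ⟩
    ⟦ ms ⟧                 ≈⟨ +-identityˡ ⟦ ms ⟧ ⟨
    0# + ⟦ ms ⟧            ≈⟨ +-congʳ (hasZeroFactor⇒≈0 m z) ⟨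
    ⟦ m ⟧ₘ + ⟦ ms ⟧        ∎

  open import Algebra.Solver.Ring.NaturalCoefficients.Default commutativeSemiring
    using (Polynomial; con; var; _:+_; _:*_; prove) renaming (⟦_⟧ to ⟦_⟧ₚ; ⟦_⟧↓ to ⟦_⟧ₚ↓)
  open import Algebra.Properties.AbelianGroup +-abelianGroup using (xyx⁻¹≈y)
  open import Algebra.Properties.CommutativeSemigroup *-commutativeSemigroup using (xy∙z≈zy∙x)

  -- With t = xⱼ - xᵢ, i.e. xⱼ = xᵢ + t, no weight involves a subtraction.
  env : Vec Carrier 4
  env = β ∷ xᵢ ∷ xⱼ - xᵢ ∷ y ∷ []

  βᵖ xᵢᵖ tᵖ yᵖ xⱼᵖ : Polynomial 4
  βᵖ  = var zero
  xᵢᵖ = var (suc zero)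
  tᵖ  = var (suc (suc zero))
  yᵖ  = var (suc (suc (suc zero)))
  xⱼᵖ = xᵢᵖ :+ tᵖ

  polyʷ : WValue → Polynomial 4 → Polynomial 4
  polyʷ 0ʷ       x = con 0
  polyʷ 1ʷ       x = con 1
  polyʷ β[x⊕y]   x = βᵖ :* (x :+ yᵖ :+ βᵖ :* x :* yᵖ)
  polyʷ 1+β[x⊕y] x = con 1 :+ βᵖ :* (x :+ yᵖ :+ βᵖ :* x :* yᵖ)

  polyʳ : RValue → Polynomial 4
  polyʳ 0ʳ       = con 0
  polyʳ 1+βxᵢ    = con 1 :+ βᵖ :* xᵢᵖ
  polyʳ 1+βxⱼ    = con 1 :+ βᵖ :* xⱼᵖ
  polyʳ β[xⱼ-xᵢ] = βᵖ :* tᵖ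

  poly : List Monomial → Polynomial 4
  poly = foldr (λ (r , wⱼ , wᵢ) p → polyʳ r :* polyʷ wⱼ xⱼᵖ :* polyʷ wᵢ xᵢᵖ :+ p) (con 0)

  xᵢ+t≈xⱼ : ⟦ xⱼᵖ ⟧ₚ env ≈ xⱼ
  xᵢ+t≈xⱼ = ≈-trans (≈-sym (+-assoc xᵢ xⱼ (- xᵢ))) (xyx⁻¹≈y xᵢ xⱼ)

  ⊕-cong : ∀ {x x′} → x ≈ x′ → ⊕ β x y ≈ ⊕ β x′ y
  ⊕-cong x≈x′ = +-cong (+-congʳ x≈x′) (*-congʳ (*-congˡ x≈x′))

  ⟦polyʷ⟧ : ∀ w {x p} → ⟦ p ⟧ₚ env ≈ x → ⟦ polyʷ w p ⟧ₚ env ≈ ⟦ w ⟧ʷ x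
  ⟦polyʷ⟧ 0ʷ       _   = ≈-refl
  ⟦polyʷ⟧ 1ʷ       _   = ≈-refl
  ⟦polyʷ⟧ β[x⊕y]   p≈x = *-congˡ (⊕-cong p≈x)
  ⟦polyʷ⟧ 1+β[x⊕y] p≈x = +-congˡ (*-congˡ (⊕-cong p≈x))

  ⟦polyʳ⟧ : ∀ r → ⟦ polyʳ r ⟧ₚ env ≈ ⟦ r ⟧ʳ
  ⟦polyʳ⟧ 0ʳ       = ≈-refl
  ⟦polyʳ⟧ 1+βxᵢ    = ≈-refl
  ⟦polyʳ⟧ 1+βxⱼ    = +-congˡ (*-congˡ xᵢ+t≈xⱼ)
  ⟦polyʳ⟧ β[xⱼ-xᵢ] = ≈-refl

  ⟦poly⟧ : ∀ ms → ⟦ poly ms ⟧ₚ env ≈ ⟦ ms ⟧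
  ⟦poly⟧ []                  = ≈-refl
  ⟦poly⟧ ((r , wⱼ , wᵢ) ∷ ms) =
    +-cong (*-cong (*-cong (⟦polyʳ⟧ r) (⟦polyʷ⟧ wⱼ xᵢ+t≈xⱼ)) (⟦polyʷ⟧ wᵢ ≈-refl)) (⟦poly⟧ ms)

  SameNormalForm : Identity → Set ℓ
  SameNormalForm (l , r) = ⟦ poly l ⟧ₚ↓ env ≈ ⟦ poly r ⟧ₚ↓ env

  sameNormalForm⇒≈ : ∀ l r → SameNormalForm (l , r) → ⟦ l ⟧ ≈ ⟦ r ⟧
  sameNormalForm⇒≈ l r sameNormalForm = begin
    ⟦ l ⟧           ≈⟨ ⟦poly⟧ l ⟨
    ⟦ poly l ⟧ₚ env ≈⟨ prove env (poly l) (poly r) sameNormalForm ⟩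
    ⟦ poly r ⟧ₚ env ≈⟨ ⟦poly⟧ r ⟩
    ⟦ r ⟧           ∎

  yangBaxterCases-normalForms : All SameNormalForm yangBaxterCases
  yangBaxterCases-normalForms =
    ≈-refl ∷ ≈-refl ∷ ≈-refl ∷ ≈-refl ∷ ≈-refl ∷ ≈-refl ∷ ≈-refl ∷ ≈-refl ∷ ≈-refl ∷ ≈-refl ∷ []

  balanced⇒≈ : ∀ {l r} → Balanced (l , r) → ⟦ l ⟧ ≈ ⟦ r ⟧
  balanced⇒≈         (inj₁ refl)    = ≈-refl
  balanced⇒≈ {l} {r} (inj₂ l,r∈cases) =
    sameNormalForm⇒≈ l r (All.lookup yangBaxterCases-normalForms l,r∈cases)

  W-vanishes : ∀ {n} x (l t r b : Fin (suc n)) → b ≢ forcedBottom l t r → W β x y l t r b ≈ 0#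
  W-vanishes x l t r b b≢forced =
    reflexive (trans (W≡⟦Wˢ⟧ x l t r b) (cong (λ w → ⟦ w ⟧ʷ x) (Wˢ-support l t r b b≢forced)))

  Rw-vanishes : ∀ {n} (bl tl tr br : Fin (suc n)) → (tr , br) ≢ (tl , bl) → (tr , br) ≢ (bl , tl) →
                Rw β xᵢ xⱼ bl tl tr br ≈ 0#
  Rw-vanishes bl tl tr br ≢straight ≢crossed =
    reflexive (trans (Rw≡⟦Rˢ⟧ bl tl tr br) (cong ⟦_⟧ʳ (Rˢ-support bl tl tr br ≢straight ≢crossed)))

  module _ {n} (a b c d e f : Fin (suc n)) where

    lhs-collapse : ∑ (λ p → ∑ (λ q → ∑ (λ r → Rw β xᵢ xⱼ a b p q * W β xⱼ y p c d r * W β xᵢ y q r e f)))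
                   ≈ ⟦ lhsˢ a b c d e f ⟧
    lhs-collapse = begin
      ∑ (λ p → ∑ (λ q → ∑ (λ r → Rw β xᵢ xⱼ a b p q * W β xⱼ y p c d r * W β xᵢ y q r e f)))
        ≈⟨ ∑-cong (∑-cong ∘ collapseMiddleEdge) ⟩
      ∑ (λ p → ∑ (term p))
        ≈⟨ ∑∑-orderings term b a (λ p q ≢straight ≢crossed →
             product-zero (inj₁ (Rw-vanishes a b p q ≢straight ≢crossed))) ⟩
      sumMap (uncurry term) (orderings b a)
        ≈⟨ sumMap-map {h = lhsTerm a b c d e f} (λ (p , q) → reflexive
             (cong₂ _*_ (cong₂ _*_ (Rw≡⟦Rˢ⟧ a b p q) (W≡⟦Wˢ⟧ xⱼ p c d _)) (W≡⟦Wˢ⟧ xᵢ q _ e f)))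
             (orderings b a) ⟩
      ⟦ lhsˢ a b c d e f ⟧ ∎
      where
      term : Fin (suc n) → Fin (suc n) → Carrier
      term p q = let r = forcedBottom p c d in Rw β xᵢ xⱼ a b p q * W β xⱼ y p c d r * W β xᵢ y q r e f
      collapseMiddleEdge : ∀ p q →
        ∑ (λ r → Rw β xᵢ xⱼ a b p q * W β xⱼ y p c d r * W β xᵢ y q r e f) ≈ term p q
      collapseMiddleEdge p q = ∑-single (forcedBottom p c d) λ r r≢forced →
        product-zero (inj₂ (inj₁ (W-vanishes xⱼ p c d r r≢forced)))

    rhs-collapse : ∑ (λ p → ∑ (λ q → ∑ (λ r → W β xᵢ y b c p r * W β xⱼ y a r q f * Rw β xᵢ xⱼ q p d e)))
                   ≈ ⟦ rhsˢ a b c d e f ⟧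
    rhs-collapse = begin
      ∑ (λ p → ∑ (λ q → ∑ (λ r → W β xᵢ y b c p r * W β xⱼ y a r q f * Rw β xᵢ xⱼ q p d e)))
        ≈⟨ ∑-cong (∑-cong ∘ collapseMiddleEdge) ⟩
      ∑ (λ p → ∑ (term p))
        ≈⟨ ∑∑-orderings term d e (λ p q ≢straight ≢crossed →
             product-zero (inj₂ (inj₂
               (Rw-vanishes q p d e (≢straight ∘ sym) (≢crossed ∘ sym ∘ cong swap))))) ⟩
      sumMap (uncurry term) (orderings d e)
        ≈⟨ sumMap-map {h = rhsTerm a b c d e f} (λ (p , q) → ≈-trans (xy∙z≈zy∙x _ _ _)
             (reflexive (cong₂ _*_ (cong₂ _*_ (Rw≡⟦Rˢ⟧ q p d e) (W≡⟦Wˢ⟧ xⱼ a _ q f)) (W≡⟦Wˢ⟧ xᵢ b c p _))))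
             (orderings d e) ⟩
      ⟦ rhsˢ a b c d e f ⟧ ∎
      where
      term : Fin (suc n) → Fin (suc n) → Carrier
      term p q = let r = forcedBottom b c p in W β xᵢ y b c p r * W β xⱼ y a r q f * Rw β xᵢ xⱼ q p d e
      collapseMiddleEdge : ∀ p q →
        ∑ (λ r → W β xᵢ y b c p r * W β xⱼ y a r q f * Rw β xᵢ xⱼ q p d e) ≈ term p q
      collapseMiddleEdge p q = ∑-single (forcedBottom b c p) λ r r≢forced →
        product-zero (inj₁ (W-vanishes xᵢ b c p r r≢forced))

proposition3p2 : ∀ {c ℓ : Level} (R : CommutativeRing c ℓ) →
    let open CommutativeRing R
        open Model R
    in ∀ (n : ℕ) (β xi xj y : Carrier) (a b c' d e f : Fin (suc n)) →
      ∑ (λ p → ∑ (λ q → ∑ (λ r →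
          Rw β xi xj a b p q * W β xj y p c' d r * W β xi y q r e f)))
      ≈
      ∑ (λ p → ∑ (λ q → ∑ (λ r →
          W β xi y b c' p r * W β xj y a r q f * Rw β xi xj q p d e)))
proposition3p2 R n β xi xj y a b c' d e f = begin
  _                                  ≈⟨ lhs-collapse a b c' d e f ⟩
  ⟦ lhsˢ a b c' d e f ⟧              ≈⟨ ⟦dropZeros⟧ (lhsˢ a b c' d e f) ⟨
  ⟦ dropZeros (lhsˢ a b c' d e f) ⟧  ≈⟨ balanced⇒≈ (sides-balanced a b c' d e f) ⟩
  ⟦ dropZeros (rhsˢ a b c' d e f) ⟧  ≈⟨ ⟦dropZeros⟧ (rhsˢ a b c' d e f) ⟩
  ⟦ rhsˢ a b c' d e f ⟧              ≈⟨ rhs-collapse a b c' d e f ⟨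
  _                                  ∎
  where
  open CommutativeRing R using (setoid)
  open Evaluation R β xi xj y
  open import Relation.Binary.Reasoning.Setoid setoid
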